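{- Let $S$ be a sorting sequence with $r>1$ distinct values and multiplicities $p_1,\dots,p_r$, $p=\sum p_i$, $c=\gcd(p_1,\dots,p_r)$, and $F_{\min}=\sum_{i=1}^r(i-1)p_i$. If there exists a general solution for $S$ with $f$ fake coins, then there exists a general solution $(f_1,\dots,f_r)$ for $S$ with $f$ fake coins in which no pile has more than $(2p-p_1-p_r)/c+f/p-F_{\min}/p$ fake coins, i.e. $f_r\le (2p-p_1-p_r)/c+f/p-F_{\min}/p$.
   Context: A sorting sequence of length $p$ is a non-decreasing sequence of $p$ non-negative integers beginning with $0$ in which each entry equals the previous one or exceeds it by $1$ (recording the outcome of sorting $p$ piles of coins by weight). If its distinct entries are $0,\dots,r-1$, let $p_i\ge1$ be the number of entries equal to $i-1$. A general solution with $f$ fake coins is an integer tuple $(f_1,\dots,f_r)$ with $0\le f_1<\dots<f_r$ and $\sum_i p_if_i=f$ ($f_i$ = number of fake coins in each pile marked $i-1$). -}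

module Defs where

open import Data.Nat using (ℕ; zero; suc; _+_; _*_; _<_; _≟_)
open import Data.Nat.GCD using (gcd)
open import Data.Fin using (Fin; toℕ)
open import Data.List using (List; []; _∷_; length; filter; map; foldr; allFin)
open import Data.Nat.ListAction using (sum)
open import Data.List.Membership.Propositional using (_∈_)
open import Data.Product using (_×_)
open import Data.Sum using (_⊎_)
open import Data.Unit using (⊤)
open import Data.Empty using (⊥)
open import Relation.Binary.PropositionalEquality using (_≡_)

Steps : ℕ → List ℕ → Set
Steps a []      = ⊤
Steps a (b ∷ s) = (b ≡ a ⊎ b ≡ suc a) × Steps b s

IsSortingSeq : List ℕ → Set
IsSortingSeq []      = ⊥
IsSortingSeq (x ∷ s) = x ≡ 0 × Steps x s

HasDistinctValues : List ℕ → ℕ → Set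
HasDistinctValues S r = ∀ x → (x ∈ S → x < r) × (x < r → x ∈ S)

countVal : ℕ → List ℕ → ℕ
countVal v S = length (filter (_≟ v) S)

-- multiplicity p_{i+1} (0-indexed: index i ↦ number of entries equal to i)
mult : List ℕ → (r : ℕ) → Fin r → ℕ
mult S r i = countVal (toℕ i) S

gcdMult : List ℕ → ℕ → ℕ
gcdMult S r = foldr gcd 0 (map (mult S r) (allFin r))

Fmin : List ℕ → ℕ → ℕ
Fmin S r = sum (map (λ i → toℕ i * mult S r i) (allFin r))

weightedSum : List ℕ → (r : ℕ) → (Fin r → ℕ) → ℕ
weightedSum S r fs = sum (map (λ i → mult S r i * fs i) (allFin r))

StrictlyIncreasing : {r : ℕ} → (Fin r → ℕ) → Set
StrictlyIncreasing {r} fs = ∀ (i j : Fin r) → toℕ i < toℕ j → fs i < fs j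

-- General solution with f fake coins (0 ≤ f_1 automatic in ℕ).
GeneralSolution : List ℕ → (r : ℕ) → ℕ → (Fin r → ℕ) → Set
GeneralSolution S r f fs = StrictlyIncreasing fs × weightedSum S r fs ≡ f

module Submission where

-- Writing a general solution as f_i = g_i + (i - 1) turns strict increase into
-- monotonicity of g, and gives Σ p_i f_i = c Σ q_i g_i + F_min with q_i = p_i / c
-- and K = Σ q_i = p / c.  A monotone g can be reshaped, keeping Σ q_i g_i and
-- monotonicity, until g_r - g_1 < K, by a pigeonhole argument on residues mod K.
-- Then p g_1 ≤ Σ p_i g_i = f - F_min bounds g_1, f_r < g_1 + K + r - 1, and the
-- r - 2 middle piles each have at least c coins, so p_1 + p_r ≤ p - (r - 2) c;
-- multiplying through by c p and adding up gives the bound.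

open import Defs
open import Data.Nat
  using (ℕ; zero; suc; _+_; _*_; _∸_; _⊓_; _<_; _≤_; _≡ᵇ_; _<?_; z≤n; s≤s; s≤s⁻¹; NonZero; >-nonZero; >-nonZero⁻¹)
open import Data.Nat.Properties
open import Data.Nat.DivMod using (_%_; _/_; m%n<n; m≡m%n+[m/n]*n; /-monoˡ-≤)
open import Data.Nat.Divisibility using (_∣_; quotient; m∣n⇒n≡quotient*m; quotient≢0; ∣-trans; ∣⇒≤)
open import Data.Nat.GCD using (gcd; gcd[m,n]∣m; gcd[m,n]∣n)
open import Data.Nat.Induction using (<-rec)
open import Data.Nat.Tactic.RingSolver using (solve-∀)
import Data.Nat.ListAction as ListAction
open import Algebra.Properties.Semiring.Sum +-*-semiring
  using (sum; sum-syntax; ∑-distrib-+; *-distribˡ-sum; *-distribʳ-sum; sum-cong-≗; sum-init-last; sum-replicate-zero)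
open import Data.Fin using (Fin; zero; suc; toℕ; fromℕ; fromℕ<; inject₁)
open import Data.Fin.Properties
  using (pigeonhole; toℕ<n; toℕ≤pred[n]; toℕ-fromℕ; toℕ-fromℕ<; fromℕ<-injective; toℕ-injective)
open import Data.List using (List; []; _∷_; [_]; length; map; foldr; allFin; tabulate)
open import Data.List.Properties using (map-tabulate)
open import Data.List.Membership.Propositional using (_∈_)
open import Data.List.Membership.Propositional.Properties using (∈-filter⁺; ∈-map⁺; ∈-allFin)
open import Data.List.Relation.Unary.Any using (here; there)
open import Data.List.Relation.Unary.All as All using (All; []; _∷_)
open import Data.Bool using (true; false)
open import Data.Product using (Σ; _×_; _,_; proj₁; proj₂; ∃-syntax; ∃₂)
open import Function using (_∘_; id)
open import Relation.Nullary using (yes; no)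
open import Relation.Binary.PropositionalEquality using (_≡_; refl; sym; trans; cong; cong₂; subst; subst₂; module ≡-Reasoning)

sum-mono-≤ : ∀ {n} {u v : Fin n → ℕ} → (∀ i → u i ≤ v i) → sum u ≤ sum v
sum-mono-≤ {zero}  _   = z≤n
sum-mono-≤ {suc n} u≤v = +-mono-≤ (u≤v zero) (sum-mono-≤ (u≤v ∘ suc))

≤-sum : ∀ {n} (u : Fin n → ℕ) i → u i ≤ sum u
≤-sum u zero    = m≤m+n (u zero) _
≤-sum u (suc i) = ≤-trans (≤-sum (u ∘ suc) i) (m≤n+m _ (u zero))

*-≤-sum : ∀ {n} c (u : Fin n → ℕ) → (∀ i → c ≤ u i) → n * c ≤ sum u
*-≤-sum {zero}  c u c≤u = z≤n
*-≤-sum {suc n} c u c≤u = +-mono-≤ (c≤u zero) (*-≤-sum c (u ∘ suc) (c≤u ∘ suc))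

first+*+last≤sum : ∀ {n} c (u : Fin (suc (suc n)) → ℕ) → (∀ i → c ≤ u i) →
                   u zero + (n * c + u (fromℕ (suc n))) ≤ sum u
first+*+last≤sum {n} c u c≤u = +-monoʳ-≤ (u zero) (begin
  n * c + u (fromℕ (suc n))                    ≤⟨ +-monoˡ-≤ _ (*-≤-sum c _ (c≤u ∘ suc ∘ inject₁)) ⟩
  sum (u ∘ suc ∘ inject₁) + u (fromℕ (suc n))  ≡⟨ sum-init-last (u ∘ suc) ⟨
  sum (u ∘ suc)                                ∎)
  where open ≤-Reasoning

sum-tabulate : ∀ {n} (u : Fin n → ℕ) → ListAction.sum (tabulate u) ≡ sum u
sum-tabulate {zero}  u = refl
sum-tabulate {suc n} u = cong (u zero +_) (sum-tabulate (u ∘ suc))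

sum-map-allFin : ∀ {n} (u : Fin n → ℕ) → ListAction.sum (map u (allFin n)) ≡ sum u
sum-map-allFin {n} u = trans (cong ListAction.sum (map-tabulate id u)) (sum-tabulate u)

infix 7 _·_

_·_ : ∀ {n} → (Fin n → ℕ) → (Fin n → ℕ) → ℕ
q · g = sum λ i → q i * g i

·-cong : ∀ {n} (q : Fin n → ℕ) {g h : Fin n → ℕ} → (∀ i → g i ≡ h i) → q · g ≡ q · h
·-cong q g≗h = sum-cong-≗ λ i → cong (q i *_) (g≗h i)

·-distribʳ-+ : ∀ {n} (q g h : Fin n → ℕ) → q · (λ i → g i + h i) ≡ q · g + q · h
·-distribʳ-+ q g h =
  trans (sum-cong-≗ λ i → *-distribˡ-+ (q i) (g i) (h i)) (∑-distrib-+ (λ i → q i * g i) (λ i → q i * h i))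

·-const : ∀ {n} (q : Fin n → ℕ) m → q · (λ _ → m) ≡ sum q * m
·-const q m = sym (*-distribʳ-sum m q)

·-scaleˡ : ∀ {n} (q g : Fin n → ℕ) c → (λ i → q i * c) · g ≡ c * (q · g)
·-scaleˡ q g c = trans (sum-cong-≗ λ i → rearrange (q i) c (g i)) (sym (*-distribˡ-sum c (λ i → q i * g i)))
  where
  rearrange : ∀ q c g → q * c * g ≡ c * (q * g)
  rearrange = solve-∀

*-≤-· : ∀ {n} (q g : Fin n → ℕ) {x} → (∀ i → x ≤ g i) → sum q * x ≤ q · g
*-≤-· q g {x} x≤g = subst (_≤ q · g) (·-const q x) (sum-mono-≤ λ i → *-monoʳ-≤ (q i) (x≤g i))

pigeonhole-% : ∀ K .{{_ : NonZero K}} (h : ℕ → ℕ) →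
               ∃₂ λ a b → a < b × b ≤ K × h a % K ≡ h b % K
pigeonhole-% K h with i , j , i<j , hᵢ≡hⱼ ← pigeonhole (n<1+n K) (λ x → fromℕ< (m%n<n (h (toℕ x)) K))
  = toℕ i , toℕ j , i<j , toℕ≤pred[n] j , fromℕ<-injective _ _ _ _ hᵢ≡hⱼ

%-≡⇒≡+* : ∀ {x y} K .{{_ : NonZero K}} → x ≤ y → x % K ≡ y % K → ∃[ m ] y ≡ x + K * m
%-≡⇒≡+* {x} {y} K x≤y x%≡y% = m , (begin
  y                            ≡⟨ m≡m%n+[m/n]*n y K ⟩
  y % K + y / K * K            ≡⟨ cong₂ (λ r d → r + d * K) x%≡y% (m+[n∸m]≡n (/-monoˡ-≤ K x≤y)) ⟨
  x % K + (x / K + m) * K      ≡⟨ cong (x % K +_) (*-distribʳ-+ K (x / K) m) ⟩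
  x % K + (x / K * K + m * K)  ≡⟨ +-assoc (x % K) _ _ ⟨
  x % K + x / K * K + m * K    ≡⟨ cong₂ _+_ (m≡m%n+[m/n]*n x K) (*-comm K m) ⟨
  x + K * m                    ∎)
  where
  open ≡-Reasoning
  m = y / K ∸ x / K

-- Compressing monotone profiles

Monotone : ∀ {n} → (Fin n → ℕ) → Set
Monotone {n} g = ∀ (i j : Fin n) → toℕ i ≤ toℕ j → g i ≤ g j

SpreadAtMost : ∀ {n} → ℕ → (Fin (suc n) → ℕ) → Set
SpreadAtMost D g = ∀ i → g i ≤ g zero + D

squeeze : ∀ {n} (A B m : ℕ) → (Fin n → ℕ) → Fin n → ℕ
squeeze A B m g i = A ⊓ g i + m + (g i ∸ B)

squeeze-monotone : ∀ {n} A B m {g : Fin n → ℕ} → Monotone g → Monotone (squeeze A B m g)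
squeeze-monotone A B m mono i j i≤j =
  +-mono-≤ (+-monoˡ-≤ m (⊓-monoʳ-≤ A (mono i j i≤j))) (∸-monoˡ-≤ B (mono i j i≤j))

·-squeeze : ∀ {n} (q g : Fin n → ℕ) A B m →
            q · (λ i → B ⊓ g i) ≡ q · (λ i → A ⊓ g i) + sum q * m →
            q · squeeze A B m g ≡ q · g
·-squeeze q g A B m mass-eq = begin
  q · squeeze A B m g                        ≡⟨ ·-distribʳ-+ q _ _ ⟩
  q · (λ i → A ⊓ g i + m) + excess           ≡⟨ cong (_+ excess) (·-distribʳ-+ q _ _) ⟩
  q · (λ i → A ⊓ g i) + q · (λ _ → m) + excess
    ≡⟨ cong (λ x → q · (λ i → A ⊓ g i) + x + excess) (·-const q m) ⟩
  q · (λ i → A ⊓ g i) + sum q * m + excess   ≡⟨ cong (_+ excess) mass-eq ⟨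
  q · (λ i → B ⊓ g i) + excess               ≡⟨ ·-distribʳ-+ q _ _ ⟨
  q · (λ i → B ⊓ g i + (g i ∸ B))            ≡⟨ ·-cong q (λ i → m⊓n+n∸m≡n B (g i)) ⟩
  q · g                                      ∎
  where
  open ≡-Reasoning
  excess = q · (λ i → g i ∸ B)

squeeze-spread : ∀ {n D} a b m (g : Fin (suc n) → ℕ) → SpreadAtMost D g →
                 SpreadAtMost (D ∸ b + a) (squeeze (g zero + a) (g zero + b) m g)
squeeze-spread {D = D} a b m g spread i = begin
  (z + a) ⊓ g i + m + (g i ∸ (z + b))
    ≤⟨ +-mono-≤ (+-monoˡ-≤ m (m⊓n≤m (z + a) (g i))) (∸-monoˡ-≤ (z + b) (spread i)) ⟩
  z + a + m + (z + D ∸ (z + b))   ≡⟨ cong (z + a + m +_) ([m+n]∸[m+o]≡n∸o z D b) ⟩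
  z + a + m + (D ∸ b)             ≡⟨ rearrange z a m (D ∸ b) ⟩
  z + m + (D ∸ b + a)             ≡⟨ cong (_+ (D ∸ b + a)) squeeze-zero ⟨
  squeeze (z + a) (z + b) m g zero + (D ∸ b + a) ∎
  where
  open ≤-Reasoning
  z = g zero
  squeeze-zero : squeeze (z + a) (z + b) m g zero ≡ z + m
  squeeze-zero = trans (cong₂ (λ x y → x + m + y) (m≥n⇒m⊓n≡n (m≤m+n z a)) (m≤n⇒m∸n≡0 (m≤m+n z b)))
                       (+-identityʳ (z + m))
  rearrange : ∀ z a m d → z + a + m + d ≡ z + m + (d + a)
  rearrange = solve-∀

module Compression {n} (q : Fin (suc n) → ℕ) {{_ : NonZero (sum q)}} where

  K : ℕ
  K = sum q

  record Compressed (g : Fin (suc n) → ℕ) : Set where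
    constructor compressed
    field
      profile     : Fin (suc n) → ℕ
      monotone    : Monotone profile
      same-weight : q · profile ≡ q · g
      spread<K    : ∀ i → profile i < profile zero + K

  truncatedMass : (Fin (suc n) → ℕ) → ℕ → ℕ
  truncatedMass g y = q · (λ i → y ⊓ g i)

  truncatedMass-mono : ∀ g {x y} → x ≤ y → truncatedMass g x ≤ truncatedMass g y
  truncatedMass-mono g x≤y = sum-mono-≤ λ i → *-monoʳ-≤ (q i) (⊓-monoˡ-≤ (g i) x≤y)

  -- Among the K + 1 truncated masses at the levels g 0, …, g 0 + K two agree
  -- modulo K; collapsing the band between those levels and lifting every entry
  -- by their difference divided by K keeps the weighted sum and shrinks the spread.
  squeeze-step : ∀ {D} g → K ≤ D → Monotone g → SpreadAtMost D g →
                 ∃[ D′ ] D′ < D × ∃[ g′ ] Monotone g′ × q · g′ ≡ q · g × SpreadAtMost D′ g′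
  squeeze-step {D} g K≤D mono spread
    with a , b , a<b , b≤K , mass≡ ← pigeonhole-% K (λ x → truncatedMass g (g zero + x))
    with m , mass-eq ← %-≡⇒≡+* K (truncatedMass-mono g (+-monoʳ-≤ (g zero) (<⇒≤ a<b))) mass≡
    = D ∸ b + a , shrinks , squeeze A B m g , squeeze-monotone A B m mono
    , ·-squeeze q g A B m mass-eq , squeeze-spread a b m g spread
    where
    A = g zero + a
    B = g zero + b
    shrinks : D ∸ b + a < D
    shrinks = ≤-trans (+-monoʳ-< (D ∸ b) a<b) (≤-reflexive (m∸n+n≡m (≤-trans b≤K K≤D)))

  compress-from : ∀ D g → Monotone g → SpreadAtMost D g → Compressed g
  compress-from = <-rec _ go
    where
    go : ∀ D → (∀ {D′} → D′ < D → ∀ g → Monotone g → SpreadAtMost D′ g → Compressed g) →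
         ∀ g → Monotone g → SpreadAtMost D g → Compressed g
    go D rec g mono spread with D <? K
    ... | yes D<K = compressed g mono refl λ i → ≤-<-trans (spread i) (+-monoʳ-< (g zero) D<K)
    ... | no D≮K with D′ , D′<D , g′ , mono′ , same′ , spread′ ← squeeze-step g (≮⇒≥ D≮K) mono spread
      with compressed g″ mono″ same″ spread″ ← rec D′<D g′ mono′ spread′
      = compressed g″ mono″ (trans same″ same′) spread″

  compress : ∀ g → Monotone g → Compressed g
  compress g mono = compress-from (sum g) g mono λ i → ≤-trans (≤-sum g i) (m≤n+m (sum g) (g zero))

countVal-∷ : ∀ x S v → countVal v (x ∷ S) ≡ countVal v [ x ] + countVal v S
countVal-∷ x S v with x ≡ᵇ v
... | true  = refl
... | false = refl

countVal-[suc] : ∀ x v → countVal (suc v) [ suc x ] ≡ countVal v [ x ]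
countVal-[suc] x v with x ≡ᵇ v
... | true  = refl
... | false = refl

∑countVal-singleton : ∀ {r x} → x < r → ∑[ i < r ] countVal (toℕ i) [ x ] ≡ 1
∑countVal-singleton {suc r} {zero}  _   = cong suc (sum-replicate-zero r)
∑countVal-singleton {suc r} {suc x} x<r =
  trans (sum-cong-≗ {r} (countVal-[suc] x ∘ toℕ)) (∑countVal-singleton (s≤s⁻¹ x<r))

length≡∑countVal : ∀ {r} S → All (_< r) S → length S ≡ ∑[ i < r ] countVal (toℕ i) S
length≡∑countVal {r} []      []          = sym (sum-replicate-zero r)
length≡∑countVal {r} (x ∷ S) (x<r ∷ S<r) = begin
  1 + length S
    ≡⟨ cong₂ _+_ (sym (∑countVal-singleton x<r)) (length≡∑countVal S S<r) ⟩
  ∑[ i < r ] countVal (toℕ i) [ x ] + ∑[ i < r ] countVal (toℕ i) S ≡⟨ ∑-distrib-+ {r} _ _ ⟨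
  ∑[ i < r ] (countVal (toℕ i) [ x ] + countVal (toℕ i) S)        ≡⟨ sum-cong-≗ {r} (countVal-∷ x S ∘ toℕ) ⟨
  ∑[ i < r ] countVal (toℕ i) (x ∷ S)                            ∎
  where open ≡-Reasoning

countVal-nonZero : ∀ {v S} → v ∈ S → NonZero (countVal v S)
countVal-nonZero {v} v∈S = nonEmpty (∈-filter⁺ (_≟ v) v∈S refl)
  where
  nonEmpty : ∀ {xs : List ℕ} → v ∈ xs → NonZero (length xs)
  nonEmpty {_ ∷ _} _ = _

foldr-gcd∣ : ∀ {xs x} → x ∈ xs → foldr gcd 0 xs ∣ x
foldr-gcd∣ {y ∷ xs} (here refl) = gcd[m,n]∣m y (foldr gcd 0 xs)
foldr-gcd∣ {y ∷ xs} (there x∈xs) = ∣-trans (gcd[m,n]∣n y (foldr gcd 0 xs)) (foldr-gcd∣ x∈xs)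

gcdMult∣mult : ∀ S r i → gcdMult S r ∣ mult S r i
gcdMult∣mult S r i = foldr-gcd∣ (∈-map⁺ (mult S r) (∈-allFin i))

weightedSum≡· : ∀ S r (g : Fin r → ℕ) → weightedSum S r g ≡ mult S r · g
weightedSum≡· S r g = sum-map-allFin (λ i → mult S r i * g i)

weightedSum-cong : ∀ S r {g h : Fin r → ℕ} → (∀ i → g i ≡ h i) → weightedSum S r g ≡ weightedSum S r h
weightedSum-cong S r {g} {h} g≗h =
  trans (weightedSum≡· S r g) (trans (·-cong (mult S r) g≗h) (sym (weightedSum≡· S r h)))

Fmin≡·toℕ : ∀ S r → Fmin S r ≡ mult S r · toℕ
Fmin≡·toℕ S r =
  trans (sum-map-allFin (λ i → toℕ i * mult S r i)) (sum-cong-≗ λ i → *-comm (toℕ i) (mult S r i))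

weightedSum-shift : ∀ S r (g : Fin r → ℕ) →
                    weightedSum S r (λ i → g i + toℕ i) ≡ mult S r · g + Fmin S r
weightedSum-shift S r g = begin
  weightedSum S r (λ i → g i + toℕ i)  ≡⟨ weightedSum≡· S r _ ⟩
  mult S r · (λ i → g i + toℕ i)       ≡⟨ ·-distribʳ-+ (mult S r) g toℕ ⟩
  mult S r · g + mult S r · toℕ        ≡⟨ cong (mult S r · g +_) (Fmin≡·toℕ S r) ⟨
  mult S r · g + Fmin S r              ∎
  where open ≡-Reasoning

module _ {r} (f : Fin r → ℕ) (increasing : StrictlyIncreasing f) where

  strictlyIncreasing-gap : ∀ d {i j} → toℕ j ≡ d + toℕ i → d + f i ≤ f j
  strictlyIncreasing-gap zero    {i} {j} j≡i = ≤-reflexive (cong f (toℕ-injective (sym j≡i)))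
  strictlyIncreasing-gap (suc d) {i} {j} j≡1+d+i = begin
    suc (d + f i) ≤⟨ s≤s (strictlyIncreasing-gap d (toℕ-fromℕ< d+i<r)) ⟩
    suc (f j′)    ≤⟨ increasing j′ j (subst (_< toℕ j) (sym (toℕ-fromℕ< d+i<r)) d+i<j) ⟩
    f j           ∎
    where
    open ≤-Reasoning
    d+i<j : d + toℕ i < toℕ j
    d+i<j = ≤-reflexive (sym j≡1+d+i)
    d+i<r : d + toℕ i < r
    d+i<r = <-trans d+i<j (toℕ<n j)
    j′ = fromℕ< d+i<r

  toℕ≤strictlyIncreasing : ∀ i → toℕ i ≤ f i
  toℕ≤strictlyIncreasing zero    = z≤n
  toℕ≤strictlyIncreasing (suc i) =
    ≤-trans (m≤m+n _ _) (strictlyIncreasing-gap (toℕ (suc i)) (sym (+-identityʳ _)))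

  unshift-monotone : Monotone (λ i → f i ∸ toℕ i)
  unshift-monotone i j i≤j = begin
    f i ∸ toℕ i              ≡⟨ [m+n]∸[m+o]≡n∸o d (f i) (toℕ i) ⟨
    d + f i ∸ (d + toℕ i)    ≡⟨ cong (d + f i ∸_) j≡d+i ⟨
    d + f i ∸ toℕ j          ≤⟨ ∸-monoˡ-≤ (toℕ j) (strictlyIncreasing-gap d j≡d+i) ⟩
    f j ∸ toℕ j              ∎
    where
    open ≤-Reasoning
    d = toℕ j ∸ toℕ i
    j≡d+i : toℕ j ≡ d + toℕ i
    j≡d+i = sym (m∸n+n≡m i≤j)

  weightedSum-unshift : ∀ S → weightedSum S r (λ i → (f i ∸ toℕ i) + toℕ i) ≡ weightedSum S r f
  weightedSum-unshift S = weightedSum-cong S r λ i → m∸n+n≡m (toℕ≤strictlyIncreasing i)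

shift-strictlyIncreasing : ∀ {r} {g : Fin r → ℕ} → Monotone g → StrictlyIncreasing (λ i → g i + toℕ i)
shift-strictlyIncreasing mono i j i<j = +-mono-≤-< (mono i j (<⇒≤ i<j)) i<j

shift-spread : ∀ {k K} {g : Fin (suc (suc k)) → ℕ} → (∀ i → g i < g zero + K) →
               ∀ i → g i + toℕ i ≤ g zero + K + k
shift-spread {k} {K} {g} spread i =
  s≤s⁻¹ (subst (g i + toℕ i <_) (+-suc (g zero + K) k) (+-mono-<-≤ (spread i) (s≤s⁻¹ (toℕ<n i))))

module Piles {S : List ℕ} {k : ℕ} (distinct : HasDistinctValues S (suc (suc k))) where

  private
    r : ℕ
    r = suc (suc k)

  c : ℕ
  c = gcdMult S r

  mult-nonZero : ∀ i → NonZero (mult S r i)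
  mult-nonZero i = countVal-nonZero (proj₂ (distinct (toℕ i)) (toℕ<n i))

  gcdMult≤mult : ∀ i → c ≤ mult S r i
  gcdMult≤mult i = ∣⇒≤ {{mult-nonZero i}} (gcdMult∣mult S r i)

  length≡∑mult : length S ≡ sum (mult S r)
  length≡∑mult = length≡∑countVal S (All.tabulate λ {x} → proj₁ (distinct x))

  ends≤length : countVal 0 S + (k * c + countVal (suc k) S) ≤ length S
  ends≤length = subst₂ (λ v P → countVal 0 S + (k * c + countVal v S) ≤ P) (toℕ-fromℕ (suc k)) (sym length≡∑mult)
                       (first+*+last≤sum c (mult S r) gcdMult≤mult)

  length*first≤weightedSum : ∀ g → Monotone g → length S * g zero + Fmin S r ≤ weightedSum S r (λ i → g i + toℕ i)
  length*first≤weightedSum g mono = begin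
    length S * g zero + Fmin S r       ≡⟨ cong (λ P → P * g zero + Fmin S r) length≡∑mult ⟩
    sum (mult S r) * g zero + Fmin S r ≤⟨ +-monoˡ-≤ (Fmin S r) (*-≤-· (mult S r) g λ j → mono zero j z≤n) ⟩
    mult S r · g + Fmin S r            ≡⟨ weightedSum-shift S r g ⟨
    weightedSum S r (λ i → g i + toℕ i) ∎
    where open ≤-Reasoning

  q : Fin r → ℕ
  q i = quotient (gcdMult∣mult S r i)

  mult≡q*c : ∀ i → mult S r i ≡ q i * c
  mult≡q*c i = m∣n⇒n≡quotient*m (gcdMult∣mult S r i)

  ∑q*c≡length : sum q * c ≡ length S
  ∑q*c≡length = sym (trans length≡∑mult (trans (sum-cong-≗ mult≡q*c) (sym (*-distribʳ-sum c q))))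

  instance
    ∑q-nonZero : NonZero (sum q)
    ∑q-nonZero = >-nonZero (≤-trans (>-nonZero⁻¹ (q zero) {{q-nonZero}}) (≤-sum q zero))
      where q-nonZero = quotient≢0 (gcdMult∣mult S r zero) {{mult-nonZero zero}}

  ·-mult : ∀ g → mult S r · g ≡ c * (q · g)
  ·-mult g = trans (sum-cong-≗ λ i → cong (_* g i) (mult≡q*c i)) (·-scaleˡ q g c)

  weightedSum-shift-≡ : ∀ g h → q · g ≡ q · h →
                        weightedSum S r (λ i → g i + toℕ i) ≡ weightedSum S r (λ i → h i + toℕ i)
  weightedSum-shift-≡ g h q·g≡q·h = begin
    weightedSum S r (λ i → g i + toℕ i) ≡⟨ weightedSum-shift S r g ⟩
    mult S r · g + Fmin S r             ≡⟨ cong (_+ Fmin S r) (·-mult g) ⟩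
    c * (q · g) + Fmin S r              ≡⟨ cong (λ x → c * x + Fmin S r) q·g≡q·h ⟩
    c * (q · h) + Fmin S r              ≡⟨ cong (_+ Fmin S r) (·-mult h) ⟨
    mult S r · h + Fmin S r             ≡⟨ weightedSum-shift S r h ⟨
    weightedSum S r (λ i → h i + toℕ i) ∎
    where open ≡-Reasoning

bound-arithmetic : ∀ c K {P k fᵢ g₀ F f P₀ Pₗ} → K * c ≡ P →
                   fᵢ ≤ g₀ + K + k → P * g₀ + F ≤ f → P₀ + (k * c + Pₗ) ≤ P →
                   c * P * fᵢ + c * F + P * (P₀ + Pₗ) ≤ 2 * P * P + c * f
bound-arithmetic c K {P} {k} {fᵢ} {g₀} {F} {f} {P₀} {Pₗ} K*c≡P fᵢ≤ weight≤ ends≤ = begin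
  c * P * fᵢ + c * F + P * (P₀ + Pₗ)
    ≤⟨ +-monoˡ-≤ _ (+-monoˡ-≤ _ (*-monoʳ-≤ (c * P) fᵢ≤)) ⟩
  c * P * (g₀ + K + k) + c * F + P * (P₀ + Pₗ)
    ≡⟨ regroup c P g₀ K k F P₀ Pₗ ⟩
  c * (P * g₀ + F) + P * (K * c) + P * (P₀ + (k * c + Pₗ))
    ≤⟨ +-mono-≤ (+-mono-≤ (*-monoʳ-≤ c weight≤) (≤-reflexive (cong (P *_) K*c≡P))) (*-monoʳ-≤ P ends≤) ⟩
  c * f + P * P + P * P
    ≡⟨ collect c f P ⟩
  2 * P * P + c * f ∎
  where
  open ≤-Reasoning
  regroup : ∀ c P g₀ K k F P₀ Pₗ →
    c * P * (g₀ + K + k) + c * F + P * (P₀ + Pₗ) ≡ c * (P * g₀ + F) + P * (K * c) + P * (P₀ + (k * c + Pₗ))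
  regroup = solve-∀
  collect : ∀ c f P → c * f + P * P + P * P ≡ 2 * P * P + c * f
  collect = solve-∀

mainTheorem9 : (S : List ℕ) → IsSortingSeq S →
    (r : ℕ) → HasDistinctValues S r → 1 < r →
    (f : ℕ) → Σ (Fin r → ℕ) (λ gs → GeneralSolution S r f gs) →
    Σ (Fin r → ℕ) (λ fs → GeneralSolution S r f fs ×
      (∀ (i : Fin r) →
        gcdMult S r * length S * fs i + gcdMult S r * Fmin S r
          + length S * (countVal 0 S + countVal (r ∸ 1) S)
        ≤ 2 * length S * length S + gcdMult S r * f))
mainTheorem9 S _ r@(suc (suc k)) distinct (s≤s (s≤s z≤n)) f (f₀ , increasing₀ , weight₀) =
  fs , (shift-strictlyIncreasing monotone , weight) , bound
  where
  open Piles distinct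
  g₀ : Fin r → ℕ
  g₀ i = f₀ i ∸ toℕ i
  open Compression.Compressed (Compression.compress q g₀ (unshift-monotone f₀ increasing₀))

  fs : Fin r → ℕ
  fs i = profile i + toℕ i

  weight : weightedSum S r fs ≡ f
  weight = trans (weightedSum-shift-≡ profile g₀ same-weight) (trans (weightedSum-unshift f₀ increasing₀ S) weight₀)

  bound : ∀ i → c * length S * fs i + c * Fmin S r + length S * (countVal 0 S + countVal (suc k) S)
                ≤ 2 * length S * length S + c * f
  bound i = bound-arithmetic c (sum q) {P₀ = countVal 0 S} {Pₗ = countVal (suc k) S}
    ∑q*c≡length (shift-spread spread<K i) first≤ ends≤length
    where
    first≤ : length S * profile zero + Fmin S r ≤ f
    first≤ = ≤-trans (length*first≤weightedSum profile monotone) (≤-reflexive weight)
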